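{- Let $n\ge 2$ and $u\ge 0$ be integers, and let $d_1>d_2>\dots>d_n\ge 0$ be integers. Then $$\alpha^{(n,u,0)}_{d_1,\dots,d_n}=\begin{cases}\alpha^{(n-1,u,u)}_{d_1,\dots,d_{n-1}} & \text{if } d_n=0,\\ 0 & \text{if } d_n>0.\end{cases}$$
   Context: For integers $n\ge1$ and $u,v\ge0$ define the integer polynomial $$Q^{(n,u,v)}(x_1,\dots,x_n)=\sum_{\pi\in S_n}\operatorname{sgn}(\pi)\left(\prod_{\ell=1}^{n-1}\big(x_{\pi(1)}+\dots+x_{\pi(\ell)}\big)^u\right)(x_1+\dots+x_n)^v,$$ where $S_n$ is the symmetric group on $\{1,\dots,n\}$; for $n=1$ (empty product) this means $Q^{(1,u,v)}(x_1)=x_1^v$. For integers $d_1\ge d_2\ge\dots\ge d_n\ge 0$, $\alpha^{(n,u,v)}_{d_1,\dots,d_n}$ denotes the coefficient of the monomial $x_1^{d_1}\cdots x_n^{d_n}$ in $Q^{(n,u,v)}$; by convention $\alpha^{(n,u,v)}_{d_1,\dots,d_n}=0$ if $d_n<0$. -}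

module Defs where

open import Data.Nat as ℕ using (ℕ; zero; suc; _<_)
open import Data.Integer as ℤ using (ℤ; +_; -_)
open import Data.Fin as Fin using (Fin)
open import Data.Vec as Vec using (Vec; []; _∷_; lookup; tabulate; toList)
open import Data.Vec.Properties using (≡-dec)
open import Data.List as List using (List; []; _∷_; _++_; concatMap; map; take; upTo; allFin; length; filter; foldr)
open import Data.Product using (_×_; _,_)
open import Relation.Nullary using (does; ¬_)
open import Relation.Binary.PropositionalEquality using (_≡_)
open import Data.Bool using (Bool; true; false; if_then_else_)
open import Data.List.Relation.Unary.AllPairs using (allPairs?)
open import Data.Fin.Properties using (_≟_)
open import Relation.Nullary.Decidable using (¬?)

-- Integer polynomials in n variables x₀,…,x_{n-1}, represented as
-- (unnormalised) lists of terms  c · x^e  with e an exponent vector.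

Monomial : ℕ → Set
Monomial n = Vec ℕ n

Poly : ℕ → Set
Poly n = List (ℤ × Monomial n)

constP : ∀ {n} → ℤ → Poly n
constP c = (c , Vec.replicate _ 0) ∷ []

varP : ∀ {n} → Fin n → Poly n
varP i = (+ 1 , tabulate (λ j → if does (i ≟ j) then 1 else 0)) ∷ []

_⊕_ : ∀ {n} → Poly n → Poly n → Poly n
p ⊕ q = p ++ q

_⊗_ : ∀ {n} → Poly n → Poly n → Poly n
p ⊗ q = concatMap (λ { (a , e) → map (λ { (b , f) → (a ℤ.* b , Vec.zipWith ℕ._+_ e f) }) q }) p

scaleP : ∀ {n} → ℤ → Poly n → Poly n
scaleP c = map (λ { (a , e) → (c ℤ.* a , e) })

powP : ∀ {n} → Poly n → ℕ → Poly n
powP p zero    = constP (+ 1)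
powP p (suc k) = p ⊗ powP p k

sumP : ∀ {n} → List (Poly n) → Poly n
sumP = foldr _⊕_ []

prodP : ∀ {n} → List (Poly n) → Poly n
prodP = foldr _⊗_ (constP (+ 1))

coeff : ∀ {n} → Poly n → Monomial n → ℤ
coeff [] d = + 0
coeff ((c , e) ∷ p) d =
  if does (≡-dec ℕ._≟_ e d) then c ℤ.+ coeff p d else coeff p d

-- The symmetric group S_n: a permutation π is the vector
-- (π(1),…,π(n)) of its values; S_n is enumerated as the injective
-- vectors among all vectors in Fin n ^ n.

allVecs : ∀ {n} (k : ℕ) → List (Vec (Fin n) k)
allVecs zero    = [] ∷ []
allVecs (suc k) = concatMap (λ i → map (i ∷_) (allVecs k)) (allFin _)

Sym : (n : ℕ) → List (Vec (Fin n) n)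
Sym n = filter (λ π → allPairs? (λ i j → ¬? (i ≟ j)) (toList π)) (allVecs {n} n)

inversions : ∀ {n} → List (Fin n) → ℕ
inversions [] = 0
inversions (i ∷ is) = length (filter (λ j → j Fin.<? i) is) ℕ.+ inversions is

sgn : ∀ {n} → Vec (Fin n) n → ℤ
sgn π = (- (+ 1)) ℤ.^ inversions (toList π)

partialSum : ∀ {n} → Vec (Fin n) n → ℕ → Poly n
partialSum π ℓ = sumP (map varP (take ℓ (toList π)))

totalSum : ∀ n → Poly n
totalSum n = sumP (map varP (allFin n))

-- Q^{(n,u,v)} = Σ_π sgn(π) (∏_{ℓ=1}^{n-1} (x_{π(1)}+…+x_{π(ℓ)})^u) (x_1+…+x_n)^v
Q : (n u v : ℕ) → Poly n
Q n u v = sumP (map (λ π → scaleP (sgn π)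
            (prodP (map (λ ℓ → powP (partialSum π (suc ℓ)) u) (upTo (n ℕ.∸ 1)))
             ⊗ powP (totalSum n) v)) (Sym n))

α : (n u v : ℕ) → Vec ℕ n → ℤ
α n u v d = coeff (Q n u v) d

StrictlyDecreasing : ∀ {n} → Vec ℕ n → Set
StrictlyDecreasing {n} d = (i j : Fin n) → i Fin.< j → lookup d j < lookup d i

-- Let Q = Q^{(m+1,u,0)} = Σ_π sgn(π) F_π with F_π = ∏_{ℓ=1}^{m} (x_{π(1)}+…+x_{π(ℓ)})^u.
-- The partial sums in F_π only involve x_{π(1)},…,x_{π(m)}, so F_π does not contain the
-- variable x_{π(m+1)}.  For a strictly decreasing exponent vector (d, dₙ) every entry
-- except possibly the last one is positive, hence:
--   * if dₙ > 0 then every F_π misses a variable whose exponent is positive, and α = 0;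
--   * if dₙ = 0 then only the permutations fixing the last point contribute.  These are
--     the extensions ext σ of σ ∈ S_m; sgn(ext σ) = sgn σ, and F_{ext σ} is F_σ times
--     (x_{σ(1)}+…+x_{σ(m)})^u = (x_1+…+x_m)^u embedded into one more variable, which is
--     exactly the summand of Q^{(m,u,u)} indexed by σ.
module Submission where

open import Defs
open import Data.Nat as ℕ using (ℕ; zero; suc; _≤_; _<_; _∸_; z≤n; s≤s)
import Data.Nat.Properties as ℕP
open import Data.Integer as ℤ using (ℤ; +_; -_)
import Data.Integer.Properties as ℤP
open import Data.Fin as Fin using (Fin; inject₁; fromℕ; lower₁; toℕ)
import Data.Fin.Properties as FinP
open import Data.Vec as V using (Vec; []; _∷_; lookup; tabulate; toList; _∷ʳ_)
import Data.Vec.Properties as VP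
open import Data.List as L using (List; []; _∷_; _++_; [_]; map; filter; foldr; upTo; take; length; allFin)
import Data.List.Properties as LP
open import Data.List.Relation.Binary.Permutation.Propositional as Perm using (_↭_; ↭-refl; ↭-trans; ↭⇒↭ₛ; module PermutationReasoning)
import Data.List.Relation.Binary.Permutation.Propositional.Properties as PermP
import Data.List.Relation.Binary.Permutation.Setoid.Properties as PermS
open import Data.List.Relation.Binary.BagAndSetEquality using (∼bag⇒↭)
open import Data.List.Relation.Unary.All as All using (All; []; _∷_)
import Data.List.Relation.Unary.All.Properties as AllP
open import Data.List.Relation.Unary.AllPairs as AllPairs using ([]; _∷_; allPairs?)
import Data.List.Relation.Unary.AllPairs.Properties as AllPairsP
open import Data.List.Relation.Unary.Unique.Propositional using (Unique)
import Data.List.Relation.Unary.Unique.Propositional.Properties as UniqueP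
open import Data.List.Relation.Unary.Any as Any using (here; there)
open import Data.List.Membership.Propositional using (_∈_)
open import Data.List.Membership.Propositional.Properties using (∈-map⁺; ∈-map⁻; ∈-concat⁺′; ∈-filter⁺; ∈-filter⁻; ∈-allFin)
open import Data.List.Membership.Propositional.Properties.WithK using (unique∧set⇒bag)
open import Data.Product using (_×_; _,_; proj₁; proj₂; ∃)
open import Data.Bool using (true; false; if_then_else_)
open import Data.Empty using (⊥-elim)
open import Relation.Nullary using (does; ¬_; Dec; yes; no)
open import Relation.Nullary.Negation using (contradiction)
open import Relation.Nullary.Decidable using (¬?; does-⇔; dec-false)
open import Relation.Unary using (Decidable)
open import Relation.Binary.PropositionalEquality using (_≡_; _≢_; refl; sym; trans; cong; cong₂; subst; subst₂; setoid; module ≡-Reasoning)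
open import Function using (_∘_)
open import Function.Bundles using (mk⇔)

private
  variable
    n m : ℕ
    A : Set

-- By definition (t ∷ p) ⊗ q reduces to map (t ·ₜ_) q ++ (p ⊗ q),
-- which the proofs below use silently.
Term : ℕ → Set
Term n = ℤ × Monomial n

_·ₜ_ : Term n → Term n → Term n
(a , e) ·ₜ (b , f) = (a ℤ.* b , V.zipWith ℕ._+_ e f)

-- ⊗ is associative because the product of terms is; the proof distributes ⊗ over ++.
·ₜ-assoc : (s t w : Term n) → (s ·ₜ t) ·ₜ w ≡ s ·ₜ (t ·ₜ w)
·ₜ-assoc (a , e) (b , f) (c , g) =
  cong₂ _,_ (ℤP.*-assoc a b c) (VP.zipWith-assoc ℕP.+-assoc e f g)

⊗-identityˡ : (p : Poly n) → constP (+ 1) ⊗ p ≡ p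
⊗-identityˡ [] = refl
⊗-identityˡ ((b , f) ∷ p) =
  cong₂ _∷_ (cong₂ _,_ (ℤP.*-identityˡ b) (VP.zipWith-identityˡ ℕP.+-identityˡ f)) (⊗-identityˡ p)

⊗-identityʳ : (p : Poly n) → p ⊗ constP (+ 1) ≡ p
⊗-identityʳ [] = refl
⊗-identityʳ ((a , e) ∷ p) =
  cong₂ _∷_ (cong₂ _,_ (ℤP.*-identityʳ a) (VP.zipWith-identityʳ ℕP.+-identityʳ e)) (⊗-identityʳ p)

⊗-distribʳ-++ : (p p′ q : Poly n) → (p ++ p′) ⊗ q ≡ (p ⊗ q) ++ (p′ ⊗ q)
⊗-distribʳ-++ [] p′ q = refl
⊗-distribʳ-++ (t ∷ p) p′ q =
  trans (cong (map (t ·ₜ_) q ++_) (⊗-distribʳ-++ p p′ q)) (sym (LP.++-assoc (map (t ·ₜ_) q) _ _))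

map·ₜ-⊗ : (t : Term n) (q r : Poly n) → map (t ·ₜ_) q ⊗ r ≡ map (t ·ₜ_) (q ⊗ r)
map·ₜ-⊗ t [] r = refl
map·ₜ-⊗ t (s ∷ q) r = begin
  map ((t ·ₜ s) ·ₜ_) r ++ (map (t ·ₜ_) q ⊗ r)     ≡⟨ cong₂ _++_ (LP.map-cong (·ₜ-assoc t s) r) (map·ₜ-⊗ t q r) ⟩
  map ((t ·ₜ_) ∘ (s ·ₜ_)) r ++ map (t ·ₜ_) (q ⊗ r) ≡⟨ cong (_++ map (t ·ₜ_) (q ⊗ r)) (LP.map-∘ r) ⟩
  map (t ·ₜ_) (map (s ·ₜ_) r) ++ map (t ·ₜ_) (q ⊗ r) ≡⟨ LP.map-++ (t ·ₜ_) (map (s ·ₜ_) r) (q ⊗ r) ⟨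
  map (t ·ₜ_) ((s ∷ q) ⊗ r)                       ∎
  where open ≡-Reasoning

⊗-assoc : (p q r : Poly n) → (p ⊗ q) ⊗ r ≡ p ⊗ (q ⊗ r)
⊗-assoc [] q r = refl
⊗-assoc (t ∷ p) q r = begin
  (map (t ·ₜ_) q ++ (p ⊗ q)) ⊗ r          ≡⟨ ⊗-distribʳ-++ (map (t ·ₜ_) q) (p ⊗ q) r ⟩
  (map (t ·ₜ_) q ⊗ r) ++ ((p ⊗ q) ⊗ r)    ≡⟨ cong₂ _++_ (map·ₜ-⊗ t q r) (⊗-assoc p q r) ⟩
  map (t ·ₜ_) (q ⊗ r) ++ (p ⊗ (q ⊗ r))    ∎
  where open ≡-Reasoning

prodP-∷ʳ : (ps : List (Poly n)) (p : Poly n) → prodP (ps L.∷ʳ p) ≡ prodP ps ⊗ p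
prodP-∷ʳ [] p = trans (⊗-identityʳ p) (sym (⊗-identityˡ p))
prodP-∷ʳ (q ∷ ps) p = trans (cong (q ⊗_) (prodP-∷ʳ ps p)) (sym (⊗-assoc q (prodP ps) p))

⊗-congˡ : {p p′ : Poly n} (q : Poly n) → p ↭ p′ → (p ⊗ q) ↭ (p′ ⊗ q)
⊗-congˡ q Perm.refl = ↭-refl
⊗-congˡ q (Perm.prep t h) = PermP.++⁺ˡ (map (t ·ₜ_) q) (⊗-congˡ q h)
⊗-congˡ q (Perm.swap t s h) =
  ↭-trans (PermP.shifts (map (t ·ₜ_) q) (map (s ·ₜ_) q))
          (PermP.++⁺ˡ (map (s ·ₜ_) q) (PermP.++⁺ˡ (map (t ·ₜ_) q) (⊗-congˡ q h)))
⊗-congˡ q (Perm.trans h h′) = ↭-trans (⊗-congˡ q h) (⊗-congˡ q h′)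

⊗-congʳ : (p : Poly n) {q q′ : Poly n} → q ↭ q′ → (p ⊗ q) ↭ (p ⊗ q′)
⊗-congʳ [] h = ↭-refl
⊗-congʳ (t ∷ p) h = PermP.++⁺ (PermP.map⁺ (t ·ₜ_) h) (⊗-congʳ p h)

powP-cong : {p p′ : Poly n} (k : ℕ) → p ↭ p′ → powP p k ↭ powP p′ k
powP-cong zero h = ↭-refl
powP-cong {p = p} {p′} (suc k) h = ↭-trans (⊗-congˡ (powP p k) h) (⊗-congʳ p′ (powP-cong k h))

-- Integer sums of lists; the coefficient of x^d is the sum of the contributions of the
-- individual terms, which makes it insensitive to the order of terms and additive.
Σℤ : List ℤ → ℤ
Σℤ = foldr ℤ._+_ (+ 0)

Σℤ-↭ : {xs ys : List ℤ} → xs ↭ ys → Σℤ xs ≡ Σℤ ys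
Σℤ-↭ h = PermS.foldr-commMonoid (setoid ℤ) ℤP.+-0-isCommutativeMonoid (↭⇒↭ₛ h)

Σℤ-++ : (xs ys : List ℤ) → Σℤ (xs ++ ys) ≡ Σℤ xs ℤ.+ Σℤ ys
Σℤ-++ [] ys = sym (ℤP.+-identityˡ _)
Σℤ-++ (x ∷ xs) ys = trans (cong (λ z → x ℤ.+ z) (Σℤ-++ xs ys)) (sym (ℤP.+-assoc x (Σℤ xs) (Σℤ ys)))

termCoeff : Term n → Monomial n → ℤ
termCoeff (c , e) d = if does (VP.≡-dec ℕ._≟_ e d) then c else + 0

coeff-∷ : (t : Term n) (p : Poly n) (d : Monomial n) → coeff (t ∷ p) d ≡ termCoeff t d ℤ.+ coeff p d
coeff-∷ (c , e) p d with does (VP.≡-dec ℕ._≟_ e d)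
... | true  = refl
... | false = sym (ℤP.+-identityˡ (coeff p d))

coeff-as-sum : (p : Poly n) (d : Monomial n) → coeff p d ≡ Σℤ (map (λ t → termCoeff t d) p)
coeff-as-sum []      d = refl
coeff-as-sum (t ∷ p) d = trans (coeff-∷ t p d) (cong (λ z → termCoeff t d ℤ.+ z) (coeff-as-sum p d))

coeff-↭ : {p q : Poly n} → p ↭ q → (d : Monomial n) → coeff p d ≡ coeff q d
coeff-↭ {p = p} {q} h d = begin
  coeff p d                                ≡⟨ coeff-as-sum p d ⟩
  Σℤ (map (λ t → termCoeff t d) p)         ≡⟨ Σℤ-↭ (PermP.map⁺ (λ t → termCoeff t d) h) ⟩
  Σℤ (map (λ t → termCoeff t d) q)         ≡⟨ coeff-as-sum q d ⟨
  coeff q d                                ∎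
  where open ≡-Reasoning

coeff-++ : (p q : Poly n) (d : Monomial n) → coeff (p ++ q) d ≡ coeff p d ℤ.+ coeff q d
coeff-++ p q d = begin
  coeff (p ++ q) d                                         ≡⟨ coeff-as-sum (p ++ q) d ⟩
  Σℤ (map c (p ++ q))                                      ≡⟨ cong Σℤ (LP.map-++ c p q) ⟩
  Σℤ (map c p ++ map c q)                                  ≡⟨ Σℤ-++ (map c p) (map c q) ⟩
  Σℤ (map c p) ℤ.+ Σℤ (map c q)                            ≡⟨ cong₂ ℤ._+_ (coeff-as-sum p d) (coeff-as-sum q d) ⟨
  coeff p d ℤ.+ coeff q d                                  ∎
  where
  open ≡-Reasoning
  c : Term _ → ℤ
  c t = termCoeff t d

coeff-scaleP : (c : ℤ) (p : Poly n) (d : Monomial n) → coeff (scaleP c p) d ≡ c ℤ.* coeff p d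
coeff-scaleP c [] d = sym (ℤP.*-zeroʳ c)
coeff-scaleP c ((a , e) ∷ p) d with does (VP.≡-dec ℕ._≟_ e d)
... | true  = trans (cong (λ z → c ℤ.* a ℤ.+ z) (coeff-scaleP c p d)) (sym (ℤP.*-distribˡ-+ c a (coeff p d)))
... | false = coeff-scaleP c p d

coeff-sumP : (ps : List (Poly n)) (d : Monomial n) → coeff (sumP ps) d ≡ Σℤ (map (λ p → coeff p d) ps)
coeff-sumP [] d = refl
coeff-sumP (p ∷ ps) d = trans (coeff-++ p (sumP ps) d) (cong (λ z → coeff p d ℤ.+ z) (coeff-sumP ps d))

Σℤ-cong : (xs : List A) (f g : A → ℤ) → (∀ {x} → x ∈ xs → f x ≡ g x) → Σℤ (map f xs) ≡ Σℤ (map g xs)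
Σℤ-cong [] f g h = refl
Σℤ-cong (x ∷ xs) f g h = cong₂ ℤ._+_ (h (here refl)) (Σℤ-cong xs f g (h ∘ there))

Σℤ-zero : (xs : List A) (f : A → ℤ) → (∀ {x} → x ∈ xs → f x ≡ + 0) → Σℤ (map f xs) ≡ + 0
Σℤ-zero [] f h = refl
Σℤ-zero (x ∷ xs) f h = cong₂ ℤ._+_ (h (here refl)) (Σℤ-zero xs f (h ∘ there))

Σℤ-filter : {P : A → Set} (P? : Decidable P) (xs : List A) (f : A → ℤ) →
            (∀ {x} → x ∈ xs → ¬ P x → f x ≡ + 0) → Σℤ (map f xs) ≡ Σℤ (map f (filter P? xs))
Σℤ-filter P? [] f h = refl
Σℤ-filter P? (x ∷ xs) f h with P? x
... | yes _  = cong (λ z → f x ℤ.+ z) (Σℤ-filter P? xs f (h ∘ there))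
... | no ¬px = trans (cong₂ ℤ._+_ (h (here refl) ¬px) (Σℤ-filter P? xs f (h ∘ there))) (ℤP.+-identityˡ _)

Avoid : Fin n → Poly n → Set
Avoid j p = All (λ t → lookup (proj₂ t) j ≡ 0) p

coeff-avoid : (j : Fin n) (p : Poly n) (d : Monomial n) → Avoid j p → lookup d j ≢ 0 → coeff p d ≡ + 0
coeff-avoid j [] d _ _ = refl
coeff-avoid j ((c , e) ∷ p) d (e[j]≡0 ∷ av) d[j]≢0 with VP.≡-dec ℕ._≟_ e d
... | yes refl = contradiction e[j]≡0 d[j]≢0
... | no _     = coeff-avoid j p d av d[j]≢0

avoid-⊗ : {j : Fin n} (p q : Poly n) → Avoid j p → Avoid j q → Avoid j (p ⊗ q)
avoid-⊗ [] q _ _ = []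
avoid-⊗ {n = n} {j = j} ((a , e) ∷ p) q (e[j]≡0 ∷ ap) aq =
  AllP.++⁺ (AllP.map⁺ (All.map (λ {s} → avoid-·ₜ {s}) aq)) (avoid-⊗ p q ap aq)
  where
  avoid-·ₜ : {s : Term n} → lookup (proj₂ s) j ≡ 0 → lookup (proj₂ ((a , e) ·ₜ s)) j ≡ 0
  avoid-·ₜ {b , f} f[j]≡0 = trans (VP.lookup-zipWith ℕ._+_ j e f) (cong₂ ℕ._+_ e[j]≡0 f[j]≡0)

avoid-constP : {j : Fin n} (c : ℤ) → Avoid j (constP c)
avoid-constP {j = j} c = VP.lookup-replicate j 0 ∷ []

avoid-varP : {i j : Fin n} → i ≢ j → Avoid j (varP i)
avoid-varP {i = i} {j} i≢j = trans (VP.lookup∘tabulate _ j) (cong (λ b → if b then 1 else 0) (dec-false (i FinP.≟ j) i≢j)) ∷ []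

avoid-powP : {j : Fin n} (p : Poly n) (k : ℕ) → Avoid j p → Avoid j (powP p k)
avoid-powP p zero    _  = avoid-constP (+ 1)
avoid-powP p (suc k) ap = avoid-⊗ p (powP p k) ap (avoid-powP p k ap)

avoid-prodP : {j : Fin n} (ps : List (Poly n)) → All (Avoid j) ps → Avoid j (prodP ps)
avoid-prodP [] [] = avoid-constP (+ 1)
avoid-prodP (p ∷ ps) (ap ∷ aps) = avoid-⊗ p (prodP ps) ap (avoid-prodP ps aps)

avoid-sumP : {j : Fin n} (ps : List (Poly n)) → All (Avoid j) ps → Avoid j (sumP ps)
avoid-sumP [] [] = []
avoid-sumP (p ∷ ps) (ap ∷ aps) = AllP.++⁺ ap (avoid-sumP ps aps)

avoid-linear : {j : Fin n} (is : List (Fin n)) → All (_≢ j) is → Avoid j (sumP (map varP is))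
avoid-linear is ne = avoid-sumP (map varP is) (AllP.map⁺ (All.map avoid-varP ne))

embed : Poly m → Poly (suc m)
embed = map (λ { (c , e) → (c , e ∷ʳ 0) })

zipWith-∷ʳ : (e f : Vec ℕ m) (x y : ℕ) → V.zipWith ℕ._+_ (e ∷ʳ x) (f ∷ʳ y) ≡ V.zipWith ℕ._+_ e f ∷ʳ (x ℕ.+ y)
zipWith-∷ʳ [] [] x y = refl
zipWith-∷ʳ (a ∷ e) (b ∷ f) x y = cong (a ℕ.+ b ∷_) (zipWith-∷ʳ e f x y)

embed-⊗ : (p q : Poly m) → embed (p ⊗ q) ≡ embed p ⊗ embed q
embed-⊗ [] q = refl
embed-⊗ (t ∷ p) q = begin
  embed (map (t ·ₜ_) q ++ (p ⊗ q))          ≡⟨ LP.map-++ _ (map (t ·ₜ_) q) (p ⊗ q) ⟩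
  embed (map (t ·ₜ_) q) ++ embed (p ⊗ q)    ≡⟨ cong₂ _++_ (embed-map·ₜ t q) (embed-⊗ p q) ⟩
  map (embT t ·ₜ_) (embed q) ++ (embed p ⊗ embed q) ∎
  where
  open ≡-Reasoning
  embT : Term _ → Term _
  embT (c , e) = (c , e ∷ʳ 0)
  embed-map·ₜ : ∀ t q → embed (map (t ·ₜ_) q) ≡ map (embT t ·ₜ_) (embed q)
  embed-map·ₜ t [] = refl
  embed-map·ₜ (a , e) ((b , f) ∷ q) = cong₂ _∷_ (cong (a ℤ.* b ,_) (sym (zipWith-∷ʳ e f 0 0))) (embed-map·ₜ (a , e) q)

replicate-∷ʳ : (m : ℕ) (x : A) → V.replicate (suc m) x ≡ V.replicate m x ∷ʳ x
replicate-∷ʳ zero    x = refl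
replicate-∷ʳ (suc m) x = cong (x ∷_) (replicate-∷ʳ m x)

embed-constP : (c : ℤ) → embed {m} (constP c) ≡ constP c
embed-constP {m} c = cong (λ e → (c , e) ∷ []) (sym (replicate-∷ʳ m 0))

tabulate-∷ʳ : (m : ℕ) (f : Fin (suc m) → A) → tabulate f ≡ tabulate (f ∘ inject₁) ∷ʳ f (fromℕ m)
tabulate-∷ʳ zero    f = refl
tabulate-∷ʳ (suc m) f = cong (f Fin.zero ∷_) (tabulate-∷ʳ m (f ∘ Fin.suc))

embed-varP : (i : Fin m) → embed (varP i) ≡ varP (inject₁ i)
embed-varP {m} i = cong (λ e → (+ 1 , e) ∷ []) (sym (begin
  tabulate (δ (inject₁ i))                                            ≡⟨ tabulate-∷ʳ m (δ (inject₁ i)) ⟩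
  tabulate (δ (inject₁ i) ∘ inject₁) ∷ʳ δ (inject₁ i) (fromℕ m)       ≡⟨ cong₂ _∷ʳ_ (VP.tabulate-cong same) last≡0 ⟩
  tabulate (δ i) ∷ʳ 0                                                 ∎))
  where
  open ≡-Reasoning
  δ : ∀ {k} → Fin k → Fin k → ℕ
  δ i j = if does (i FinP.≟ j) then 1 else 0
  same : ∀ j → δ (inject₁ i) (inject₁ j) ≡ δ i j
  same j = cong (λ b → if b then 1 else 0)
    (does-⇔ (mk⇔ FinP.inject₁-injective (cong inject₁)) (inject₁ i FinP.≟ inject₁ j) (i FinP.≟ j))
  last≡0 : δ (inject₁ i) (fromℕ m) ≡ 0
  last≡0 = cong (λ b → if b then 1 else 0) (dec-false (inject₁ i FinP.≟ fromℕ m) (FinP.fromℕ≢inject₁ ∘ sym))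

embed-powP : (p : Poly m) (k : ℕ) → embed (powP p k) ≡ powP (embed p) k
embed-powP p zero    = embed-constP (+ 1)
embed-powP p (suc k) = trans (embed-⊗ p (powP p k)) (cong (embed p ⊗_) (embed-powP p k))

embed-prodP : (ps : List (Poly m)) → embed (prodP ps) ≡ prodP (map embed ps)
embed-prodP []       = embed-constP (+ 1)
embed-prodP (p ∷ ps) = trans (embed-⊗ p (prodP ps)) (cong (embed p ⊗_) (embed-prodP ps))

embed-sumP : (ps : List (Poly m)) → embed (sumP ps) ≡ sumP (map embed ps)
embed-sumP []       = refl
embed-sumP (p ∷ ps) = trans (LP.map-++ _ p (sumP ps)) (cong (embed p ++_) (embed-sumP ps))

coeff-embed : (p : Poly m) (d : Monomial m) → coeff (embed p) (d ∷ʳ 0) ≡ coeff p d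
coeff-embed [] d = refl
coeff-embed ((c , e) ∷ p) d
  rewrite does-⇔ (mk⇔ (VP.∷ʳ-injectiveˡ e d) (cong (_∷ʳ 0))) (VP.≡-dec ℕ._≟_ (e ∷ʳ 0) (d ∷ʳ 0)) (VP.≡-dec ℕ._≟_ e d)
        | coeff-embed p d = refl

∈-allVecs : (k : ℕ) (v : Vec (Fin n) k) → v ∈ allVecs k
∈-allVecs zero    []      = here refl
∈-allVecs (suc k) (i ∷ w) =
  ∈-concat⁺′ (∈-map⁺ (i ∷_) (∈-allVecs k w)) (∈-map⁺ (λ i → map (i ∷_) (allVecs k)) (∈-allFin i))

unique-allVecs : (k : ℕ) → Unique (allVecs {n} k)
unique-allVecs zero = [] ∷ []
unique-allVecs {n} (suc k) =
  UniqueP.concat⁺ (AllP.map⁺ (All.tabulate (λ _ → UniqueP.map⁺ (proj₂ ∘ VP.∷-injective) (unique-allVecs k))))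
                  (AllPairsP.map⁺ (AllPairs.map disjoint (UniqueP.allFin⁺ n)))
  where
  disjoint : ∀ {i j} → i ≢ j → ∀ {v} → ¬ (v ∈ map (i ∷_) (allVecs k) × v ∈ map (j ∷_) (allVecs k))
  disjoint i≢j (v∈i , v∈j) with ∈-map⁻ _ v∈i | ∈-map⁻ _ v∈j
  ... | _ , _ , refl | _ , _ , eq = i≢j (proj₁ (VP.∷-injective eq))

isPermutation? : (π : Vec (Fin n) n) → Dec (Unique (toList π))
isPermutation? π = allPairs? (λ i j → ¬? (i FinP.≟ j)) (toList π)

∈-Sym⁺ : (π : Vec (Fin n) n) → Unique (toList π) → π ∈ Sym n
∈-Sym⁺ {n} π u = ∈-filter⁺ isPermutation? (∈-allVecs n π) u

∈-Sym⁻ : {π : Vec (Fin n) n} → π ∈ Sym n → Unique (toList π)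
∈-Sym⁻ {n} h = proj₂ (∈-filter⁻ isPermutation? {xs = allVecs n} h)

unique-Sym : (n : ℕ) → Unique (Sym n)
unique-Sym n = UniqueP.filter⁺ isPermutation? (unique-allVecs n)

unique-↭ : {xs ys : List A} → Unique xs → Unique ys →
           (∀ {x} → x ∈ xs → x ∈ ys) → (∀ {x} → x ∈ ys → x ∈ xs) → xs ↭ ys
unique-↭ u u′ f g = ∼bag⇒↭ (unique∧set⇒bag u u′ (mk⇔ f g))

unique-length-≤ : (xs ys : List (Fin n)) → Unique xs → (∀ {x} → x ∈ xs → x ∈ ys) → length xs ≤ length ys
unique-length-≤ [] ys _ _ = z≤n
unique-length-≤ (x ∷ xs) ys (x∉xs ∷ u) xs⊆ys =
  ℕP.≤-trans (s≤s (unique-length-≤ xs (filter x≢? ys) u xs⊆ys-x))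
             (LP.filter-notAll x≢? ys (Any.map (λ x≡y x≢y → x≢y x≡y) (xs⊆ys (here refl))))
  where
  x≢? = λ y → ¬? (x FinP.≟ y)
  xs⊆ys-x : ∀ {y} → y ∈ xs → y ∈ filter x≢? ys
  xs⊆ys-x y∈xs = ∈-filter⁺ x≢? (xs⊆ys (there y∈xs)) (All.lookup x∉xs y∈xs)

unique-full : (xs : List (Fin n)) → Unique xs → length xs ≡ n → (i : Fin n) → i ∈ xs
unique-full {n} xs u len i with i ∈? xs
  where open import Data.List.Membership.DecPropositional (FinP._≟_ {n}) using (_∈?_)
... | yes i∈xs = i∈xs
... | no  i∉xs = ⊥-elim (ℕP.<-irrefl refl (ℕP.≤-<-trans n≤ <n))
  where
  i≢? = λ y → ¬? (i FinP.≟ y)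
  others = filter i≢? (allFin n)
  n≤ : n ≤ length others
  n≤ = subst (_≤ length others) len (unique-length-≤ xs others u
         (λ {y} y∈xs → ∈-filter⁺ i≢? (∈-allFin y) (λ i≡y → i∉xs (subst (_∈ xs) (sym i≡y) y∈xs))))
  <n : length others < n
  <n = subst (length others <_) (LP.length-tabulate (λ j → j))
         (LP.filter-notAll i≢? (allFin n) (Any.map (λ i≡j i≢j → i≢j i≡j) (∈-allFin i)))

permutation-↭-allFin : {σ : Vec (Fin m) m} → σ ∈ Sym m → toList σ ↭ allFin m
permutation-↭-allFin {m} {σ} h = unique-↭ (∈-Sym⁻ h) (UniqueP.allFin⁺ m) (λ {x} _ → ∈-allFin x)
  (λ {x} _ → unique-full (toList σ) (∈-Sym⁻ h) (VP.length-toList σ) x)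

lookup-last : (w : Vec A m) (x : A) → lookup (w ∷ʳ x) (fromℕ m) ≡ x
lookup-last []      x = refl
lookup-last (a ∷ w) x = lookup-last w x

unique-∷ʳ⁻ : (xs : List A) (y : A) → Unique (xs ++ [ y ]) → Unique xs × All (_≢ y) xs
unique-∷ʳ⁻ [] y _ = [] , []
unique-∷ʳ⁻ (x ∷ xs) y (x∉ ∷ u) with unique-∷ʳ⁻ xs y u | AllP.++⁻ xs x∉
... | uxs , xs≢y | x∉xs , (x≢y ∷ []) = (x∉xs ∷ uxs) , (x≢y ∷ xs≢y)

take-∷ʳ : (ℓ : ℕ) (xs : List A) (y : A) → ℓ ≤ length xs → take ℓ (xs ++ [ y ]) ≡ take ℓ xs
take-∷ʳ zero    xs       y _         = refl
take-∷ʳ (suc ℓ) (x ∷ xs) y (s≤s ℓ≤) = cong (x ∷_) (take-∷ʳ ℓ xs y ℓ≤)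

take-toList-∷ʳ : (ℓ : ℕ) (w : Vec A m) (y : A) → ℓ ≤ m → take ℓ (toList (w ∷ʳ y)) ≡ take ℓ (toList w)
take-toList-∷ʳ ℓ w y ℓ≤m = trans (cong (take ℓ) (VP.toList-∷ʳ y w))
  (take-∷ʳ ℓ (toList w) y (subst (ℓ ≤_) (sym (VP.length-toList w)) ℓ≤m))

ext : Vec (Fin m) m → Vec (Fin (suc m)) (suc m)
ext {m} σ = V.map inject₁ σ ∷ʳ fromℕ m

toList-ext : (σ : Vec (Fin m) m) → toList (ext σ) ≡ map inject₁ (toList σ) ++ [ fromℕ m ]
toList-ext {m} σ = trans (VP.toList-∷ʳ (fromℕ m) (V.map inject₁ σ)) (cong (_++ [ fromℕ m ]) (VP.toList-map inject₁ σ))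

map-inject₁-injective : {v w : Vec (Fin m) n} → V.map inject₁ v ≡ V.map inject₁ w → v ≡ w
map-inject₁-injective {v = []}    {[]}    _  = refl
map-inject₁-injective {v = a ∷ v} {b ∷ w} eq with VP.∷-injective eq
... | a≡b , v≡w = cong₂ _∷_ (FinP.inject₁-injective a≡b) (map-inject₁-injective v≡w)

ext-injective : {σ τ : Vec (Fin m) m} → ext σ ≡ ext τ → σ ≡ τ
ext-injective {σ = σ} {τ} eq = map-inject₁-injective (VP.∷ʳ-injectiveˡ (V.map inject₁ σ) (V.map inject₁ τ) eq)

ext-∈-Sym : {σ : Vec (Fin m) m} → σ ∈ Sym m → ext σ ∈ Sym (suc m)
ext-∈-Sym {m} {σ} σ∈ = ∈-Sym⁺ (ext σ) (subst Unique (sym (toList-ext σ))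
  (UniqueP.++⁺ (UniqueP.map⁺ FinP.inject₁-injective (∈-Sym⁻ σ∈)) ([] ∷ []) last-new))
  where
  last-new : ∀ {v} → ¬ (v ∈ map inject₁ (toList σ) × v ∈ [ fromℕ m ])
  last-new (v∈ , here refl) with ∈-map⁻ inject₁ v∈
  ... | _ , _ , eq = FinP.fromℕ≢inject₁ eq

lowerAll : (w : Vec (Fin (suc m)) n) → All (_≢ fromℕ m) (toList w) → Vec (Fin m) n
lowerAll [] [] = []
lowerAll {m} (i ∷ w) (i≢ ∷ ne) = lower₁ i m≢i ∷ lowerAll w ne
  where
  m≢i : m ≢ toℕ i
  m≢i m≡i = i≢ (FinP.toℕ-injective (trans (sym m≡i) (sym (FinP.toℕ-fromℕ m))))

inject₁-lowerAll : (w : Vec (Fin (suc m)) n) (ne : All (_≢ fromℕ m) (toList w)) → V.map inject₁ (lowerAll w ne) ≡ w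
inject₁-lowerAll [] [] = refl
inject₁-lowerAll (i ∷ w) (_ ∷ ne) = cong₂ _∷_ (FinP.inject₁-lower₁ i _) (inject₁-lowerAll w ne)

fixesLast? : (π : Vec (Fin (suc m)) (suc m)) → Dec (lookup π (fromℕ m) ≡ fromℕ m)
fixesLast? {m} π = lookup π (fromℕ m) FinP.≟ fromℕ m

fixesLast⇒ext : {π : Vec (Fin (suc m)) (suc m)} → π ∈ Sym (suc m) → lookup π (fromℕ m) ≡ fromℕ m →
                ∃ λ σ → σ ∈ Sym m × π ≡ ext σ
fixesLast⇒ext {m} {π} π∈ fixes with V.initLast π
... | w , x , refl with unique-∷ʳ⁻ (toList w) x (subst Unique (VP.toList-∷ʳ x w) (∈-Sym⁻ π∈))
... | uw , w≢x = σ , ∈-Sym⁺ σ uσ , cong₂ _∷ʳ_ (sym w≡) x≡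
  where
  x≡ : x ≡ fromℕ m
  x≡ = trans (sym (lookup-last w x)) fixes
  σ = lowerAll w (subst (λ z → All (_≢ z) (toList w)) x≡ w≢x)
  w≡ : V.map inject₁ σ ≡ w
  w≡ = inject₁-lowerAll w _
  uσ : Unique (toList σ)
  uσ = UniqueP.map⁻ (subst Unique (trans (cong toList (sym w≡)) (VP.toList-map inject₁ σ)) uw)

stabiliser-↭ : (m : ℕ) → filter fixesLast? (Sym (suc m)) ↭ map ext (Sym m)
stabiliser-↭ m = unique-↭ (UniqueP.filter⁺ fixesLast? (unique-Sym _)) (UniqueP.map⁺ ext-injective (unique-Sym _)) to from
  where
  to : ∀ {π} → π ∈ filter fixesLast? (Sym (suc m)) → π ∈ map ext (Sym m)
  to {π} h with ∈-filter⁻ fixesLast? {xs = Sym (suc m)} h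
  ... | π∈ , fixes with fixesLast⇒ext π∈ fixes
  ... | σ , σ∈ , refl = ∈-map⁺ ext σ∈
  from : ∀ {π} → π ∈ map ext (Sym m) → π ∈ filter fixesLast? (Sym (suc m))
  from h with ∈-map⁻ ext h
  ... | σ , σ∈ , refl = ∈-filter⁺ fixesLast? (ext-∈-Sym σ∈) (lookup-last (V.map inject₁ σ) (fromℕ m))

-- Extending by a fixed last point creates no inversions, so sgn (ext σ) = sgn σ.
count-below-ext : (i : Fin m) (xs : List (Fin m)) →
  length (filter (λ j → j Fin.<? inject₁ i) (map inject₁ xs ++ [ fromℕ m ])) ≡ length (filter (λ j → j Fin.<? i) xs)
count-below-ext {m} i [] = cong length (LP.filter-reject (λ j → j Fin.<? inject₁ i) {xs = []}
  (λ m<i → ℕP.<-asym (FinP.toℕ<n i) (subst₂ ℕ._<_ (FinP.toℕ-fromℕ m) (FinP.toℕ-inject₁ i) m<i)))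
count-below-ext i (x ∷ xs) with x Fin.<? i
... | yes x<i = begin
  length (filter below-i′ (inject₁ x ∷ rest)) ≡⟨ cong length (LP.filter-accept below-i′ (inject₁-< x<i)) ⟩
  suc (length (filter below-i′ rest))         ≡⟨ cong suc (count-below-ext i xs) ⟩
  suc (length (filter below-i xs))            ≡⟨ cong length (LP.filter-accept below-i x<i) ⟨
  length (filter below-i (x ∷ xs))            ∎
  where
  open ≡-Reasoning
  below-i = λ j → j Fin.<? i
  below-i′ = λ j → j Fin.<? inject₁ i
  rest = map inject₁ xs ++ [ fromℕ _ ]
  inject₁-< : x Fin.< i → inject₁ x Fin.< inject₁ i
  inject₁-< = subst₂ ℕ._<_ (sym (FinP.toℕ-inject₁ x)) (sym (FinP.toℕ-inject₁ i))
... | no x≮i = begin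
  length (filter below-i′ (inject₁ x ∷ rest)) ≡⟨ cong length (LP.filter-reject below-i′ (x≮i ∘ inject₁-<⁻)) ⟩
  length (filter below-i′ rest)               ≡⟨ count-below-ext i xs ⟩
  length (filter below-i xs)                  ≡⟨ cong length (LP.filter-reject below-i x≮i) ⟨
  length (filter below-i (x ∷ xs))            ∎
  where
  open ≡-Reasoning
  below-i = λ j → j Fin.<? i
  below-i′ = λ j → j Fin.<? inject₁ i
  rest = map inject₁ xs ++ [ fromℕ _ ]
  inject₁-<⁻ : inject₁ x Fin.< inject₁ i → x Fin.< i
  inject₁-<⁻ = subst₂ ℕ._<_ (FinP.toℕ-inject₁ x) (FinP.toℕ-inject₁ i)

inversions-ext : (xs : List (Fin m)) → inversions (map inject₁ xs ++ [ fromℕ m ]) ≡ inversions xs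
inversions-ext []       = refl
inversions-ext (i ∷ xs) = cong₂ ℕ._+_ (count-below-ext i xs) (inversions-ext xs)

sgn-ext : (σ : Vec (Fin m) m) → sgn (ext σ) ≡ sgn σ
sgn-ext σ = cong ((- (+ 1)) ℤ.^_) (trans (cong inversions (toList-ext σ)) (inversions-ext (toList σ)))

partialSum-ext : (σ : Vec (Fin m) m) (ℓ : ℕ) → ℓ ≤ m → partialSum (ext σ) ℓ ≡ embed (partialSum σ ℓ)
partialSum-ext {m} σ ℓ ℓ≤m = begin
  sumP (map varP (take ℓ (toList (ext σ))))              ≡⟨ cong (sumP ∘ map varP) (take-toList-∷ʳ ℓ (V.map inject₁ σ) (fromℕ m) ℓ≤m) ⟩
  sumP (map varP (take ℓ (toList (V.map inject₁ σ))))    ≡⟨ cong (λ xs → sumP (map varP (take ℓ xs))) (VP.toList-map inject₁ σ) ⟩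
  sumP (map varP (take ℓ (map inject₁ (toList σ))))      ≡⟨ cong (sumP ∘ map varP) (LP.take-map ℓ (toList σ)) ⟩
  sumP (map varP (map inject₁ (take ℓ (toList σ))))      ≡⟨ cong sumP (LP.map-∘ (take ℓ (toList σ))) ⟨
  sumP (map (varP ∘ inject₁) (take ℓ (toList σ)))        ≡⟨ cong sumP (LP.map-cong (sym ∘ embed-varP) (take ℓ (toList σ))) ⟩
  sumP (map (embed ∘ varP) (take ℓ (toList σ)))          ≡⟨ cong sumP (LP.map-∘ (take ℓ (toList σ))) ⟩
  sumP (map embed (map varP (take ℓ (toList σ))))        ≡⟨ embed-sumP (map varP (take ℓ (toList σ))) ⟨
  embed (partialSum σ ℓ)                                 ∎
  where open ≡-Reasoning

partialSum-full : {σ : Vec (Fin m) m} → σ ∈ Sym m → partialSum σ m ↭ totalSum m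
partialSum-full {m} {σ} σ∈ = begin
  sumP (map varP (take m (toList σ)))  ≡⟨ cong (sumP ∘ map varP) (LP.take-all m (toList σ) (ℕP.≤-reflexive (VP.length-toList σ))) ⟩
  sumP (map varP (toList σ))           ≡⟨ linear (toList σ) ⟩
  map varTerm (toList σ)               ↭⟨ PermP.map⁺ varTerm (permutation-↭-allFin σ∈) ⟩
  map varTerm (allFin m)               ≡⟨ linear (allFin m) ⟨
  totalSum m                           ∎
  where
  open PermutationReasoning
  varTerm : Fin m → Term m
  varTerm i = (+ 1 , tabulate (λ j → if does (i FinP.≟ j) then 1 else 0))
  linear : (is : List (Fin m)) → sumP (map varP is) ≡ map varTerm is
  linear [] = refl
  linear (i ∷ is) = cong (varTerm i ∷_) (linear is)

flagProduct : (n u : ℕ) → Vec (Fin n) n → Poly n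
flagProduct n u π = prodP (map (λ ℓ → powP (partialSum π (suc ℓ)) u) (upTo (n ∸ 1)))

summand : (n u v : ℕ) → Vec (Fin n) n → Poly n
summand n u v π = scaleP (sgn π) (flagProduct n u π ⊗ powP (totalSum n) v)

α-as-sum : (n u v : ℕ) (d : Vec ℕ n) → α n u v d ≡ Σℤ (map (λ π → coeff (summand n u v π) d) (Sym n))
α-as-sum n u v d = trans (coeff-sumP (map (summand n u v) (Sym n)) d) (cong Σℤ (sym (LP.map-∘ (Sym n))))

flagProduct-avoids-last : (u : ℕ) {π : Vec (Fin (suc m)) (suc m)} → π ∈ Sym (suc m) →
                          Avoid (lookup π (fromℕ m)) (flagProduct (suc m) u π)
flagProduct-avoids-last {m} u {π} π∈ with V.initLast π
... | w , x , refl rewrite lookup-last w x =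
  avoid-prodP _ (AllP.map⁺ (AllP.applyUpTo⁺₁ (λ ℓ → ℓ) m avoid-power))
  where
  w≢x : All (_≢ x) (toList w)
  w≢x = proj₂ (unique-∷ʳ⁻ (toList w) x (subst Unique (VP.toList-∷ʳ x w) (∈-Sym⁻ π∈)))
  avoid-power : ∀ {ℓ} → ℓ < m → Avoid x (powP (partialSum (w ∷ʳ x) (suc ℓ)) u)
  avoid-power {ℓ} ℓ<m = avoid-powP _ u (subst (Avoid x ∘ sumP ∘ map varP) (sym (take-toList-∷ʳ (suc ℓ) w x ℓ<m))
                          (avoid-linear _ (AllP.take⁺ (suc ℓ) w≢x)))

summand-vanishes : (u : ℕ) {π : Vec (Fin (suc m)) (suc m)} (D : Vec ℕ (suc m)) → π ∈ Sym (suc m) →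
                   lookup D (lookup π (fromℕ m)) ≢ 0 → coeff (summand (suc m) u 0 π) D ≡ + 0
summand-vanishes {m} u {π} D π∈ D≢0 = begin
  coeff (summand (suc m) u 0 π) D    ≡⟨ coeff-scaleP (sgn π) F D ⟩
  sgn π ℤ.* coeff F D                ≡⟨ cong (sgn π ℤ.*_) (coeff-avoid _ F D avoids D≢0) ⟩
  sgn π ℤ.* + 0                      ≡⟨ ℤP.*-zeroʳ (sgn π) ⟩
  + 0                                ∎
  where
  open ≡-Reasoning
  F = flagProduct (suc m) u π ⊗ constP (+ 1)
  avoids : Avoid (lookup π (fromℕ m)) F
  avoids = avoid-⊗ _ _ (flagProduct-avoids-last u π∈) (avoid-constP (+ 1))

flagProduct-ext : (k u : ℕ) (σ : Vec (Fin (suc k)) (suc k)) →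
  flagProduct (suc (suc k)) u (ext σ) ≡ embed (flagProduct (suc k) u σ ⊗ powP (partialSum σ (suc k)) u)
flagProduct-ext k u σ = begin
  prodP (map G (upTo (suc k)))                 ≡⟨ cong prodP (LP.map-cong-local (AllP.applyUpTo⁺₁ (λ ℓ → ℓ) (suc k) G≡embedF)) ⟩
  prodP (map (embed ∘ F) (upTo (suc k)))       ≡⟨ cong prodP (LP.map-∘ {g = embed} {f = F} (upTo (suc k))) ⟩
  prodP (map embed (map F (upTo (suc k))))     ≡⟨ embed-prodP (map F (upTo (suc k))) ⟨
  embed (prodP (map F (upTo (suc k))))         ≡⟨ cong (embed ∘ prodP ∘ map F) (LP.upTo-∷ʳ k) ⟨
  embed (prodP (map F (upTo k L.∷ʳ k)))        ≡⟨ cong (embed ∘ prodP) (LP.map-++ F (upTo k) [ k ]) ⟩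
  embed (prodP (map F (upTo k) L.∷ʳ F k))      ≡⟨ cong embed (prodP-∷ʳ (map F (upTo k)) (F k)) ⟩
  embed (flagProduct (suc k) u σ ⊗ F k)        ∎
  where
  open ≡-Reasoning
  G = λ ℓ → powP (partialSum (ext σ) (suc ℓ)) u
  F = λ ℓ → powP (partialSum σ (suc ℓ)) u
  G≡embedF : ∀ {ℓ} → ℓ < suc k → G ℓ ≡ embed (F ℓ)
  G≡embedF {ℓ} ℓ<  = trans (cong (λ p → powP p u) (partialSum-ext σ (suc ℓ) ℓ<)) (sym (embed-powP (partialSum σ (suc ℓ)) u))

summand-ext : (k u : ℕ) {σ : Vec (Fin (suc k)) (suc k)} (d : Vec ℕ (suc k)) → σ ∈ Sym (suc k) →
              coeff (summand (suc (suc k)) u 0 (ext σ)) (d ∷ʳ 0) ≡ coeff (summand (suc k) u u σ) d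
summand-ext k u {σ} d σ∈ = begin
  coeff (scaleP (sgn (ext σ)) (flagProduct (suc (suc k)) u (ext σ) ⊗ constP (+ 1))) (d ∷ʳ 0)
    ≡⟨ coeff-scaleP (sgn (ext σ)) (flagProduct (suc (suc k)) u (ext σ) ⊗ constP (+ 1)) (d ∷ʳ 0) ⟩
  sgn (ext σ) ℤ.* coeff (flagProduct (suc (suc k)) u (ext σ) ⊗ constP (+ 1)) (d ∷ʳ 0)
    ≡⟨ cong₂ (λ s p → s ℤ.* coeff p (d ∷ʳ 0)) (sgn-ext σ) (trans (⊗-identityʳ _) (flagProduct-ext k u σ)) ⟩
  sgn σ ℤ.* coeff (embed (F ⊗ powP (partialSum σ (suc k)) u)) (d ∷ʳ 0)
    ≡⟨ cong (sgn σ ℤ.*_) (coeff-embed (F ⊗ powP (partialSum σ (suc k)) u) d) ⟩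
  sgn σ ℤ.* coeff (F ⊗ powP (partialSum σ (suc k)) u) d
    ≡⟨ cong (sgn σ ℤ.*_) (coeff-↭ (⊗-congʳ F (powP-cong u (partialSum-full σ∈))) d) ⟩
  sgn σ ℤ.* coeff (F ⊗ powP (totalSum (suc k)) u) d
    ≡⟨ coeff-scaleP (sgn σ) (F ⊗ powP (totalSum (suc k)) u) d ⟨
  coeff (summand (suc k) u u σ) d ∎
  where
  open ≡-Reasoning
  F = flagProduct (suc k) u σ

above-last : (d : Vec ℕ m) (dₙ : ℕ) → StrictlyDecreasing (d ∷ʳ dₙ) →
             (j : Fin (suc m)) → j ≢ fromℕ m → dₙ < lookup (d ∷ʳ dₙ) j
above-last {m} d dₙ sd j j≢last =
  subst (_< lookup (d ∷ʳ dₙ) j) (lookup-last d dₙ) (sd j (fromℕ m) (FinP.≤∧≢⇒< (FinP.≤fromℕ j) j≢last))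

nonzero-but-last : (d : Vec ℕ m) (dₙ : ℕ) → StrictlyDecreasing (d ∷ʳ dₙ) →
                   (j : Fin (suc m)) → j ≢ fromℕ m → lookup (d ∷ʳ dₙ) j ≢ 0
nonzero-but-last d dₙ sd j j≢last = ℕP.>⇒≢ (ℕP.≤-<-trans z≤n (above-last d dₙ sd j j≢last))

nonzero-all : (d : Vec ℕ m) (dₙ : ℕ) → StrictlyDecreasing (d ∷ʳ dₙ) → 0 < dₙ →
              (j : Fin (suc m)) → lookup (d ∷ʳ dₙ) j ≢ 0
nonzero-all {m} d dₙ sd 0<dₙ j with j FinP.≟ fromℕ m
... | yes refl    = ℕP.>⇒≢ (subst (0 <_) (sym (lookup-last d dₙ)) 0<dₙ)
... | no j≢last = nonzero-but-last d dₙ sd j j≢last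

lemma2 : (m u : ℕ) → 1 ≤ m → (d : Vec ℕ m) (dₙ : ℕ) →
         StrictlyDecreasing (d ∷ʳ dₙ) →
         (dₙ ≡ 0 → α (suc m) u 0 (d ∷ʳ dₙ) ≡ α m u u d)
         × (0 < dₙ → α (suc m) u 0 (d ∷ʳ dₙ) ≡ + 0)
lemma2 m@(suc k) u _ d dₙ sd = last-zero , last-positive
  where
  c : Vec (Fin (suc m)) (suc m) → ℤ
  c π = coeff (summand (suc m) u 0 π) (d ∷ʳ dₙ)
  last-positive : 0 < dₙ → α (suc m) u 0 (d ∷ʳ dₙ) ≡ + 0
  last-positive 0<dₙ = trans (α-as-sum (suc m) u 0 (d ∷ʳ dₙ))
    (Σℤ-zero (Sym (suc m)) c (λ π∈ → summand-vanishes u (d ∷ʳ dₙ) π∈ (nonzero-all d dₙ sd 0<dₙ _)))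
  last-zero : dₙ ≡ 0 → α (suc m) u 0 (d ∷ʳ dₙ) ≡ α m u u d
  last-zero refl = begin
    α (suc m) u 0 (d ∷ʳ 0)                       ≡⟨ α-as-sum (suc m) u 0 (d ∷ʳ 0) ⟩
    Σℤ (map c (Sym (suc m)))                     ≡⟨ Σℤ-filter fixesLast? (Sym (suc m)) c moved-vanishes ⟩
    Σℤ (map c (filter fixesLast? (Sym (suc m)))) ≡⟨ Σℤ-↭ (PermP.map⁺ c (stabiliser-↭ m)) ⟩
    Σℤ (map c (map ext (Sym m)))                 ≡⟨ cong Σℤ (LP.map-∘ (Sym m)) ⟨
    Σℤ (map (c ∘ ext) (Sym m))                   ≡⟨ Σℤ-cong (Sym m) (c ∘ ext) _ (summand-ext k u d) ⟩
    Σℤ (map (λ σ → coeff (summand m u u σ) d) (Sym m)) ≡⟨ α-as-sum m u u d ⟨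
    α m u u d                                    ∎
    where
    open ≡-Reasoning
    moved-vanishes : ∀ {π} → π ∈ Sym (suc m) → lookup π (fromℕ m) ≢ fromℕ m → c π ≡ + 0
    moved-vanishes π∈ moved = summand-vanishes u (d ∷ʳ 0) π∈ (nonzero-but-last d 0 sd _ moved)
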